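{- Consider the recursive procedure which starts from the initial condition $\overset{\ast}{\mathbf{U}}_{P_1}=\overset{\ast}{\mathbf{u}}_2$ and at step $N$ forms $\overset{\ast}{\mathbf{U}}_{P_{N+1}}=\overset{\ast}{\mathbf{U}}_{P_N}\odot\overset{\ast}{\mathbf{u}}_{p_{N+1}}$, where at step $N$ one identifies as primes $p_1,\dots,p_N$ together with all phases $k$ with $p_{N+1}\le k<p_{N+1}^2$ such that $\overset{\ast}{\mathbf{U}}_{P_N}(k)\ne0$ (which, for $p_1<p_2<\cdots$ the primes, are exactly the primes less than $p_{N+1}^2$). This procedure, applied sequentially for $N=1,2,3,\dots$, does not terminate: at every step the primes needed to carry out the next step (namely the next prime co-number to multiply in, and the next prime whose square bounds the range of certified phases) have already been identified.
   Context: $p_1<p_2<p_3<\cdots$ denote the prime numbers and $P_N=p_1\cdots p_N$. For $n\in\mathbb{N}$, the natural wave number is $\mathbf{u}_n=\big(e^{2\pi i k/n}\big)_{k\in\mathbb{Z}}$ ($k$ is the phase). The co-number $\overset{\ast}{\mathbf{u}}_n$ has value $0$ at phase $k$ if $n\mid k$ and $e^{2\pi i k/n}$ otherwise. Circular product: for sequences $f_j(k)=c_j(k)e^{2\pi i k/n_j}$, $c_j(k)\in\{0,1\}$, with $P=\prod_j n_j$, $\bigodot_j f_j$ has value at phase $k$ equal to $\big(\prod_j c_j(k)\big)e^{2\pi i(\sum_j k/n_j)/\sum_j(P/n_j)}$ (the element-wise product raised element-wise, on the exponent, to the power $1/\sum_j(P/n_j)$). -}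

module Defs where

open import Data.Nat using (ℕ; zero; suc; _+_; _*_; _∸_; _^_; _≤_; _<_)
open import Data.Nat.Divisibility using (_∣?_)
open import Data.Nat.Primality using (Prime)
open import Data.Integer using (ℤ; +_; ∣_∣)
open import Data.Rational.Unnormalised.Base using (ℚᵘ; mkℚᵘ; 0ℚᵘ)
  renaming (_+_ to _+q_; _*_ to _*q_)
open import Data.Bool using (Bool; true; false; not; _∧_; if_then_else_)
open import Data.List using (List; []; _∷_; map; upTo)
open import Data.Maybe using (Maybe; just; nothing)
open import Data.Product using (Σ; _×_; ∃)
open import Data.Sum using (_⊎_)
open import Relation.Nullary using (does; ¬_)
open import Relation.Binary.PropositionalEquality using (_≡_; _≢_)

-- A value of a wave sequence at a phase: `nothing` is the value 0,
-- `just x` is the unit complex number e^{2πi x} (x ∈ ℚ).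
Val : Set
Val = Maybe ℚᵘ

-- A wave of the form f(k) = c(k) e^{2πi k/n}, c(k) ∈ {0,1}, n ≥ 1.
record PreWave : Set where
  constructor preWave
  field
    modulus : ℕ
    coeff   : ℤ → Bool
open PreWave public

-- k/n as a rational (meaningful for n ≥ 1)
_over_ : ℤ → ℕ → ℚᵘ
k over n = mkℚᵘ k (n ∸ 1)

coNumber : ℕ → PreWave
coNumber n = preWave n (λ k → not (does (n ∣? ∣ k ∣)))

prodMod : List PreWave → ℕ
prodMod []       = 1
prodMod (w ∷ ws) = modulus w * prodMod ws

-- Σ_j P/n_j  (computed without division: P/n_j = ∏_{i≠j} n_i)
sumCofactors : List PreWave → ℕ
sumCofactors []       = 0
sumCofactors (w ∷ ws) = prodMod ws + modulus w * sumCofactors ws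

allCoeff : List PreWave → ℤ → Bool
allCoeff []       k = true
allCoeff (w ∷ ws) k = coeff w k ∧ allCoeff ws k

sumPhases : List PreWave → ℤ → ℚᵘ
sumPhases []       k = 0ℚᵘ
sumPhases (w ∷ ws) k = (k over modulus w) +q sumPhases ws k

-- circular product ⊙_j f_j:
-- value (∏ c_j(k)) e^{2πi (Σ_j k/n_j) / Σ_j (P/n_j)}
circProd : List PreWave → ℤ → Val
circProd ws k =
  if allCoeff ws k
  then just (sumPhases ws k *q mkℚᵘ (+ 1) (sumCofactors ws ∸ 1))
  else nothing

-- p enumerates the primes increasingly: p 1 = p_1 = 2, p 2 = 3, ...
-- (p 0 is unused)
IsPrimeEnumeration : (ℕ → ℕ) → Set
IsPrimeEnumeration p =
  (∀ i → Prime (p (suc i))) ×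
  (∀ i j → i < j → p (suc i) < p (suc j)) ×
  (∀ q → Prime q → ∃ λ i → p (suc i) ≡ q)

-- U*_{P_N} = u*_{p_1} ⊙ ... ⊙ u*_{p_N}
-- (the recursion U*_{P_{N+1}} = U*_{P_N} ⊙ u*_{p_{N+1}}, starting from u*_2)
U : (ℕ → ℕ) → ℕ → ℤ → Val
U p N = circProd (map (λ i → coNumber (p (suc i))) (upTo N))

Identified : (ℕ → ℕ) → ℕ → ℕ → Set
Identified p N q =
  (Σ ℕ λ j → (1 ≤ j × j ≤ N) × q ≡ p j) ⊎
  ((p (suc N) ≤ q × q < p (suc N) ^ 2) × U p N (+ q) ≢ nothing)

-- For N ≥ 1, U*_{P_N}(k) ≠ 0 says exactly that none of p_1, …, p_N divides k, i.e. k has no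
-- prime factor below p_{N+1}; in the window p_{N+1} ≤ k < p_{N+1}² this is equivalent to k being
-- prime. The procedure never stalls because p_{N+2} < p_{N+1}²: there is a prime between b and b²
-- for every b ≥ 3. For b ≥ 9 this follows from Chebyshev–Nair estimates: m·binom(2m, m) divides
-- lcm(1, …, 2m), so 4^m ≤ 2·lcm(1, …, 2m); but if no prime lay in (b, b²) and 2m < b², then
-- lcm(1, …, 2m) would be a product of powers of primes ≤ b, each power at most 2m, so
-- lcm(1, …, 2m) ≤ (2m)^b, which is too small for m ≈ b²/2. Smaller b are checked directly.

module Submission where

open import Data.Bool using (true; false; T)
import Data.Integer as ℤ
open import Data.List using ([]; _∷_; map; upTo)
open import Data.List.Relation.Unary.All using (All; []; _∷_)
open import Data.List.Relation.Unary.All.Properties using (applyUpTo⁺₁; applyUpTo⁻)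
open import Data.Maybe using (nothing)
open import Data.Nat
open import Data.Nat.Divisibility
open import Data.Nat.GCD using (gcd)
open import Data.Nat.Induction using (<-rec)
open import Data.Nat.LCM using (lcm; lcm-least; lcm-comm; gcd*lcm; m∣lcm[m,n]; n∣lcm[m,n])
open import Data.Nat.ListAction using (product)
open import Data.Nat.Primality
open import Data.Nat.Primality.Factorisation using (factorise)
open import Data.Nat.Properties
open import Data.Nat.Tactic.RingSolver using (solve-∀)
open import Data.Product using (∃; ∃₂; _×_; _,_; proj₁; proj₂)
open import Data.Sum using (_⊎_; inj₁; inj₂)
open import Data.Unit using (tt)
open import Function.Base using (id)
open import Function.Bundles using (_⇔_; mk⇔; Equivalence)
open import Relation.Binary.PropositionalEquality
open import Relation.Nullary using (yes; no; ¬_; contradiction)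
open import Relation.Nullary.Decidable using (from-yes)

open import Defs

-- binom a b = (a + b) choose a, indexed so that Pascal's rule is structural.
binom : ℕ → ℕ → ℕ
binom zero    b       = 1
binom (suc a) zero    = 1
binom (suc a) (suc b) = binom a (suc b) + binom (suc a) b

binom-zeroʳ : ∀ a → binom a zero ≡ 1
binom-zeroʳ zero    = refl
binom-zeroʳ (suc a) = refl

mutual
  binom-absorbˡ : ∀ a b → suc a * binom (suc a) b ≡ suc (a + b) * binom a b
  binom-absorbˡ a zero rewrite binom-zeroʳ a = cong (λ x → suc x * 1) (sym (+-identityʳ a))
  binom-absorbˡ a (suc b) = begin
    suc a * (binom a (suc b) + binom (suc a) b)               ≡⟨ *-distribˡ-+ (suc a) (binom a (suc b)) _ ⟩
    suc a * binom a (suc b) + suc a * binom (suc a) b         ≡⟨ cong (suc a * binom a (suc b) +_) (trans (binom-absorbˡ a b) (sym (binom-absorbʳ a b))) ⟩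
    suc a * binom a (suc b) + suc b * binom a (suc b)         ≡⟨ *-distribʳ-+ (binom a (suc b)) (suc a) (suc b) ⟨
    suc (a + suc b) * binom a (suc b)                         ∎
    where open ≡-Reasoning

  binom-absorbʳ : ∀ a b → suc b * binom a (suc b) ≡ suc (a + b) * binom a b
  binom-absorbʳ zero b = refl
  binom-absorbʳ (suc a) b = begin
    suc b * (binom a (suc b) + binom (suc a) b)               ≡⟨ *-distribˡ-+ (suc b) (binom a (suc b)) _ ⟩
    suc b * binom a (suc b) + suc b * binom (suc a) b         ≡⟨ cong (_+ suc b * binom (suc a) b) (trans (binom-absorbʳ a b) (sym (binom-absorbˡ a b))) ⟩
    suc a * binom (suc a) b + suc b * binom (suc a) b         ≡⟨ *-distribʳ-+ (binom (suc a) b) (suc a) (suc b) ⟨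
    (suc a + suc b) * binom (suc a) b                         ≡⟨ cong (λ x → suc x * binom (suc a) b) (+-suc a b) ⟩
    suc (suc a + b) * binom (suc a) b                         ∎
    where open ≡-Reasoning

binom-diag-suc : ∀ n → suc n * binom (suc n) (suc n) ≡ 2 * suc (n + n) * binom n n
binom-diag-suc n = *-cancelˡ-≡ _ _ (suc n) (begin
  suc n * (suc n * binom (suc n) (suc n))                ≡⟨ cong (suc n *_) (binom-absorbˡ n (suc n)) ⟩
  suc n * (suc (n + suc n) * binom n (suc n))            ≡⟨ cong (λ x → suc n * (suc x * binom n (suc n))) (+-suc n n) ⟩
  suc n * (suc (suc (n + n)) * binom n (suc n))          ≡⟨ x*[y*z]≡y*[x*z] (suc n) (suc (suc (n + n))) (binom n (suc n)) ⟩
  suc (suc (n + n)) * (suc n * binom n (suc n))          ≡⟨ cong (suc (suc (n + n)) *_) (binom-absorbʳ n n) ⟩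
  suc (suc (n + n)) * (suc (n + n) * binom n n)          ≡⟨ regroup n (suc (n + n)) (binom n n) ⟩
  suc n * (2 * suc (n + n) * binom n n)                  ∎)
  where
  open ≡-Reasoning
  x*[y*z]≡y*[x*z] : ∀ x y z → x * (y * z) ≡ y * (x * z)
  x*[y*z]≡y*[x*z] = solve-∀
  regroup : ∀ n x t → suc (suc (n + n)) * (x * t) ≡ suc n * (2 * x * t)
  regroup = solve-∀

4^n≤2n*binom[n,n] : ∀ {n} → 1 ≤ n → 4 ^ n ≤ 2 * n * binom n n
4^n≤2n*binom[n,n] {suc zero}    _ = ≤-refl
4^n≤2n*binom[n,n] {suc (suc n)} _ = begin
  4 * 4 ^ suc n                                        ≤⟨ *-monoʳ-≤ 4 (4^n≤2n*binom[n,n] {suc n} (s≤s z≤n)) ⟩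
  4 * (2 * suc n * B)                                  ≤⟨ *-monoʳ-≤ 4 (*-monoˡ-≤ B 2[n+1]≤2n+3) ⟩
  4 * (suc (suc n + suc n) * B)                        ≡⟨ regroup (suc (suc n + suc n)) B ⟩
  2 * (2 * suc (suc n + suc n) * B)                    ≡⟨ cong (2 *_) (binom-diag-suc (suc n)) ⟨
  2 * (suc (suc n) * binom (suc (suc n)) (suc (suc n))) ≡⟨ *-assoc 2 (suc (suc n)) (binom (suc (suc n)) (suc (suc n))) ⟨
  2 * suc (suc n) * binom (suc (suc n)) (suc (suc n))   ∎
  where
  open ≤-Reasoning
  B = binom (suc n) (suc n)
  2[n+1]≤2n+3 : 2 * suc n ≤ suc (suc n + suc n)
  2[n+1]≤2n+3 rewrite +-identityʳ n = n≤1+n (suc n + suc n)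
  regroup : ∀ x t → 4 * (x * t) ≡ 2 * (2 * x * t)
  regroup = solve-∀

-- Nair: the identity (k+1)·[m·binom (k+1) m] = (k+m+1)·[m·binom k m] = m·[(m+1)·binom k (m+1)]
-- shows that L/(m·binom (k+1) m) = L/(m·binom k m) − L/((m+1)·binom k (m+1)).
m*binom∣commonMultiple : ∀ {L n} → (∀ {i} → 1 ≤ i → i ≤ n → i ∣ L) →
                         ∀ k {m} → 1 ≤ m → k + m ≤ n → m * binom k m ∣ L
m*binom∣commonMultiple {L} all∣L zero {m} 1≤m m≤n =
  subst (_∣ L) (sym (*-identityʳ m)) (all∣L 1≤m m≤n)
m*binom∣commonMultiple {L} {n} all∣L (suc k) {m} 1≤m k+m<n
  with m*binom∣commonMultiple all∣L k 1≤m (≤-trans (n≤1+n (k + m)) k+m<n)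
     | m*binom∣commonMultiple all∣L k (s≤s z≤n) (subst (_≤ n) (sym (+-suc k m)) k+m<n)
... | divides f L≡f*d₁ | divides g L≡g*d₂ = divides (f ∸ g) (*-cancelʳ-≡ L _ (suc k) (begin
  L * suc k                                    ≡⟨ cong (L *_) (m+n∸n≡m (suc k) m) ⟨
  L * (K ∸ m)                                  ≡⟨ *-distribˡ-∸ L K m ⟩
  L * K ∸ L * m                                ≡⟨ cong₂ _∸_ (cong (_* K) L≡f*d₁) (cong (_* m) L≡g*d₂) ⟩
  f * (m * t) * K ∸ g * d₂ * m                 ≡⟨ cong₂ _∸_ (regroupˡ f m K t) (trans (regroupʳ g (suc m) m _) (cong (λ x → g * (m * x)) (binom-absorbʳ k m))) ⟩
  f * (m * (K * t)) ∸ g * (m * (K * t))        ≡⟨ *-distribʳ-∸ (m * (K * t)) f g ⟨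
  (f ∸ g) * (m * (K * t))                      ≡⟨ cong (λ x → (f ∸ g) * (m * x)) (binom-absorbˡ k m) ⟨
  (f ∸ g) * (m * (suc k * binom (suc k) m))    ≡⟨ regroupˡ (f ∸ g) m (suc k) (binom (suc k) m) ⟨
  (f ∸ g) * (m * binom (suc k) m) * suc k      ∎))
  where
  open ≡-Reasoning
  K = suc (k + m)
  t = binom k m
  d₂ = suc m * binom k (suc m)
  regroupˡ : ∀ f m K t → f * (m * t) * K ≡ f * (m * (K * t))
  regroupˡ = solve-∀
  regroupʳ : ∀ g x m u → g * (x * u) * m ≡ g * (m * (x * u))
  regroupʳ = solve-∀

prime⇒2≤ : ∀ {q} → Prime q → 2 ≤ q
prime⇒2≤ {q} q-prime = nonTrivial⇒n>1 q {{prime⇒nonTrivial q-prime}}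

∃prime∣ : ∀ {n} → 1 < n → ∃ λ q → Prime q × q ∣ n
∃prime∣ {n} 1<n with factorise n {{>-nonZero (<-trans z<s 1<n)}}
... | record { factors = [] ; isFactorisation = n≡1 } = contradiction n≡1 (>⇒≢ 1<n)
... | record { factors = q ∷ qs ; isFactorisation = n≡q*Πqs ; factorsPrime = q-prime ∷ _ } =
  q , q-prime , divides (product qs) (trans n≡q*Πqs (*-comm q (product qs)))

^-monoʳ-∣ : ∀ q {k t} → k ≤ t → q ^ k ∣ q ^ t
^-monoʳ-∣ q {k} {t} k≤t = divides (q ^ (t ∸ k))
  (trans (cong (q ^_) (sym (m∸n+n≡m k≤t))) (^-distribˡ-+-* q (t ∸ k) k))

∃[s,r]n≡qˢ*r∧q∤r : ∀ {q} → 1 < q → ∀ n → 0 < n → ∃₂ λ s r → n ≡ q ^ s * r × ¬ q ∣ r × 0 < r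
∃[s,r]n≡qˢ*r∧q∤r {q} 1<q = <-rec _ split
  where
  split : ∀ n → (∀ {m} → m < n → 0 < m → ∃₂ λ s r → m ≡ q ^ s * r × ¬ q ∣ r × 0 < r) →
          0 < n → ∃₂ λ s r → n ≡ q ^ s * r × ¬ q ∣ r × 0 < r
  split n rec 0<n with q ∣? n
  ... | no q∤n = 0 , n , sym (*-identityˡ n) , q∤n , 0<n
  ... | yes (divides m n≡m*q) =
    let instance m≢0 = m*n≢0⇒m≢0 m {{subst NonZero n≡m*q (>-nonZero 0<n)}}
        s , r , m≡qˢ*r , q∤r , 0<r = rec (subst (m <_) (sym n≡m*q) (m<m*n m q 1<q)) (>-nonZero⁻¹ m)
    in suc s , r , trans n≡m*q (trans (cong (_* q) m≡qˢ*r) (regroup q (q ^ s) r)) , q∤r , 0<r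
    where
    regroup : ∀ q x r → x * r * q ≡ q * x * r
    regroup = solve-∀

qᵏ∣qᵗ*r⇒k≤t : ∀ {q r} → Prime q → ¬ q ∣ r → ∀ k t → q ^ k ∣ q ^ t * r → k ≤ t
qᵏ∣qᵗ*r⇒k≤t _       _   zero    _       _ = z≤n
qᵏ∣qᵗ*r⇒k≤t {q} {r} _ q∤r (suc k) zero    d =
  contradiction (∣-trans (m∣m*n (q ^ k)) (subst (q ^ suc k ∣_) (*-identityˡ r) d)) q∤r
qᵏ∣qᵗ*r⇒k≤t {q} {r} q-prime q∤r (suc k) (suc t) d = s≤s (qᵏ∣qᵗ*r⇒k≤t q-prime q∤r k t
  (*-cancelˡ-∣ q {{prime⇒nonZero q-prime}} (subst (q * q ^ k ∣_) (*-assoc q (q ^ t) r) d)))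

-- Both a and c divide q ^ t * (a' * c') when t is the larger valuation.
prime-pow∣lcm⇒∣larger : ∀ {q a c a' c' s t} k → Prime q →
  a ≡ q ^ s * a' → ¬ q ∣ a' → c ≡ q ^ t * c' → ¬ q ∣ c' → s ≤ t →
  q ^ k ∣ lcm a c → q ^ k ∣ c
prime-pow∣lcm⇒∣larger {q} {a} {c} {a'} {c'} {s} {t} k q-prime a≡ q∤a' c≡ q∤c' s≤t qᵏ∣lcm =
  subst (q ^ k ∣_) (sym c≡) (∣-trans (^-monoʳ-∣ q k≤t) (m∣m*n c'))
  where
  M = q ^ t * (a' * c')
  a∣M : a ∣ M
  a∣M = subst (_∣ M) (sym a≡) (*-pres-∣ (^-monoʳ-∣ q s≤t) (m∣m*n c'))
  c∣M : c ∣ M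
  c∣M = subst (_∣ M) (sym c≡) (*-monoʳ-∣ (q ^ t) (n∣m*n a'))
  q∤a'c' : ¬ q ∣ a' * c'
  q∤a'c' q∣a'c' with euclidsLemma a' c' q-prime q∣a'c'
  ... | inj₁ q∣a' = q∤a' q∣a'
  ... | inj₂ q∣c' = q∤c' q∣c'
  k≤t : k ≤ t
  k≤t = qᵏ∣qᵗ*r⇒k≤t q-prime q∤a'c' k t (∣-trans qᵏ∣lcm (lcm-least a∣M c∣M))

prime-pow∣lcm : ∀ {q a c} k → Prime q → 0 < a → 0 < c → q ^ k ∣ lcm a c → q ^ k ∣ a ⊎ q ^ k ∣ c
prime-pow∣lcm {q} {a} {c} k q-prime 0<a 0<c qᵏ∣lcm
  with ∃[s,r]n≡qˢ*r∧q∤r (prime⇒2≤ q-prime) a 0<a | ∃[s,r]n≡qˢ*r∧q∤r (prime⇒2≤ q-prime) c 0<c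
... | s , a' , a≡ , q∤a' , _ | t , c' , c≡ , q∤c' , _ with ≤-total s t
...   | inj₁ s≤t = inj₂ (prime-pow∣lcm⇒∣larger k q-prime a≡ q∤a' c≡ q∤c' s≤t qᵏ∣lcm)
...   | inj₂ t≤s = inj₁ (prime-pow∣lcm⇒∣larger k q-prime c≡ q∤c' a≡ q∤a' t≤s
                           (subst (_ ∣_) (lcm-comm a c) qᵏ∣lcm))

lcm-pos : ∀ {a c} → 0 < a → 0 < c → 0 < lcm a c
lcm-pos {a} {c} 0<a 0<c = >-nonZero⁻¹ (lcm a c) {{m*n≢0⇒n≢0 (gcd a c) {{gcd*lcm≢0}}}}
  where
  gcd*lcm≢0 : NonZero (gcd a c * lcm a c)
  gcd*lcm≢0 = subst NonZero (sym (gcd*lcm a c)) (m*n≢0 a c {{>-nonZero 0<a}} {{>-nonZero 0<c}})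

lcmUpTo : ℕ → ℕ
lcmUpTo zero    = 1
lcmUpTo (suc n) = lcm (lcmUpTo n) (suc n)

lcmUpTo-pos : ∀ n → 0 < lcmUpTo n
lcmUpTo-pos zero    = z<s
lcmUpTo-pos (suc n) = lcm-pos (lcmUpTo-pos n) z<s

∣lcmUpTo : ∀ {n i} → 1 ≤ i → i ≤ n → i ∣ lcmUpTo n
∣lcmUpTo {zero}  (s≤s _) ()
∣lcmUpTo {suc n} {i} 1≤i i≤1+n with m≤n⇒m<n∨m≡n i≤1+n
... | inj₁ i<1+n = ∣-trans (∣lcmUpTo 1≤i (s≤s⁻¹ i<1+n)) (m∣lcm[m,n] (lcmUpTo n) (suc n))
... | inj₂ refl  = n∣lcm[m,n] (lcmUpTo n) (suc n)

prime-pow∣lcmUpTo⇒≤ : ∀ {q} k {n} → Prime q → 1 ≤ n → q ^ k ∣ lcmUpTo n → q ^ k ≤ n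
prime-pow∣lcmUpTo⇒≤ k {suc n} q-prime _ qᵏ∣L
  with prime-pow∣lcm k q-prime (lcmUpTo-pos n) z<s qᵏ∣L
... | inj₂ qᵏ∣1+n = ∣⇒≤ qᵏ∣1+n
prime-pow∣lcmUpTo⇒≤ k {suc zero}    _       _ _ | inj₁ qᵏ∣1 = ∣⇒≤ qᵏ∣1
prime-pow∣lcmUpTo⇒≤ k {suc (suc n)} q-prime _ _ | inj₁ qᵏ∣L =
  m≤n⇒m≤1+n (prime-pow∣lcmUpTo⇒≤ k q-prime z<s qᵏ∣L)

-- The primes ≤ b can only contribute a factor ≤ X each to n, so n > X ^ b forces a larger prime.
∃large-prime∣ : ∀ {X} b {n} → 0 < n → (∀ q k → Prime q → q ^ k ∣ n → q ^ k ≤ X) →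
                X ^ b < n → ∃ λ q → Prime q × q ∣ n × b < q
∃large-prime∣ zero 0<n _ 1<n with ∃prime∣ 1<n
... | q , q-prime , q∣n = q , q-prime , q∣n , <-trans z<s (prime⇒2≤ q-prime)
∃large-prime∣ {X} (suc b) {n} 0<n bound Xᵇ⁺¹<n with prime? (suc b)
... | no ¬prime =
  let q , q-prime , q∣n , b<q = ∃large-prime∣ b 0<n bound Xᵇ<n
  in q , q-prime , q∣n , ≤∧≢⇒< b<q (λ b+1≡q → ¬prime (subst Prime (sym b+1≡q) q-prime))
  where
  instance X≢0 = >-nonZero (bound 2 0 prime[2] (1∣ n))
  Xᵇ<n : X ^ b < n
  Xᵇ<n = ≤-<-trans (m≤n*m (X ^ b) X) Xᵇ⁺¹<n
... | yes b+1-prime with ∃[s,r]n≡qˢ*r∧q∤r (prime⇒2≤ b+1-prime) n 0<n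
...   | s , r , n≡ , b+1∤r , 0<r =
  let q , q-prime , q∣r , b<q =
        ∃large-prime∣ b 0<r (λ q k q-prime qᵏ∣r → bound q k q-prime (∣-trans qᵏ∣r r∣n)) Xᵇ<r
  in q , q-prime , ∣-trans q∣r r∣n , ≤∧≢⇒< b<q (λ b+1≡q → b+1∤r (subst (_∣ r) (sym b+1≡q) q∣r))
  where
  r∣n : r ∣ n
  r∣n = subst (r ∣_) (sym n≡) (n∣m*n (suc b ^ s))
  Xᵇ<r : X ^ b < r
  Xᵇ<r = *-cancelˡ-< X (X ^ b) r (<-≤-trans Xᵇ⁺¹<n (begin
    n               ≡⟨ n≡ ⟩
    suc b ^ s * r   ≤⟨ *-monoˡ-≤ r (bound (suc b) s b+1-prime (∣-trans (m∣m*n r) (∣-reflexive (sym n≡)))) ⟩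
    X * r           ∎))
    where open ≤-Reasoning

[m*n]^o≡m^o*n^o : ∀ m n o → (m * n) ^ o ≡ m ^ o * n ^ o
[m*n]^o≡m^o*n^o m n zero    = refl
[m*n]^o≡m^o*n^o m n (suc o) =
  trans (cong (m * n *_) ([m*n]^o≡m^o*n^o m n o)) (regroup m n (m ^ o) (n ^ o))
  where
  regroup : ∀ a b c d → a * b * (c * d) ≡ a * c * (b * d)
  regroup = solve-∀

∃prime-between-square : ∀ {b h} → h + h < b → 2 * (b * b) < 4 ^ h →
                        ∃ λ r → Prime r × b < r × r < b * b
∃prime-between-square {suc _} {zero} _ (s≤s ())
∃prime-between-square {b@(suc _)} {h@(suc _)} h+h<b 2b²<4ʰ =
  let q , q-prime , q∣L , b<q = ∃large-prime∣ b (lcmUpTo-pos X) prime-pow≤X Xᵇ<L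
  in q , q-prime , b<q , ≤-<-trans (q≤X q-prime q∣L) X<b²
  where
  m = b * h
  X = m + m
  L = lcmUpTo X
  1≤X : 1 ≤ X
  1≤X = ≤-trans (s≤s z≤n) (m≤m+n m m)
  X<b² : X < b * b
  X<b² = subst (_< b * b) (*-distribˡ-+ b h h) (*-monoʳ-< b h+h<b)
  prime-pow≤X : ∀ q k → Prime q → q ^ k ∣ L → q ^ k ≤ X
  prime-pow≤X q k q-prime = prime-pow∣lcmUpTo⇒≤ k q-prime 1≤X
  q≤X : ∀ {q} → Prime q → q ∣ L → q ≤ X
  q≤X {q} q-prime q∣L = subst (_≤ X) (*-identityʳ q)
    (prime-pow≤X q 1 q-prime (subst (_∣ L) (sym (*-identityʳ q)) q∣L))
  4ᵐ≤2L : 4 ^ m ≤ 2 * L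
  4ᵐ≤2L = begin
    4 ^ m                ≤⟨ 4^n≤2n*binom[n,n] {m} (s≤s z≤n) ⟩
    2 * m * binom m m    ≡⟨ *-assoc 2 m (binom m m) ⟩
    2 * (m * binom m m)  ≤⟨ *-monoʳ-≤ 2 (∣⇒≤ {{>-nonZero (lcmUpTo-pos X)}}
                              (m*binom∣commonMultiple ∣lcmUpTo m (s≤s z≤n) ≤-refl)) ⟩
    2 * L                ∎
    where open ≤-Reasoning
  2Xᵇ<4ᵐ : 2 * X ^ b < 4 ^ m
  2Xᵇ<4ᵐ = begin-strict
    2 * X ^ b            ≤⟨ *-monoʳ-≤ 2 (^-monoˡ-≤ b (<⇒≤ X<b²)) ⟩
    2 * (b * b) ^ b      ≤⟨ *-monoˡ-≤ ((b * b) ^ b) (^-monoʳ-≤ 2 {1} {b} (s≤s z≤n)) ⟩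
    2 ^ b * (b * b) ^ b  ≡⟨ [m*n]^o≡m^o*n^o 2 (b * b) b ⟨
    (2 * (b * b)) ^ b    <⟨ ^-monoˡ-< b 2b²<4ʰ ⟩
    (4 ^ h) ^ b          ≡⟨ ^-*-assoc 4 h b ⟩
    4 ^ (h * b)          ≡⟨ cong (4 ^_) (*-comm h b) ⟩
    4 ^ m                ∎
    where open ≤-Reasoning
  Xᵇ<L : X ^ b < L
  Xᵇ<L = *-cancelˡ-< 2 (X ^ b) L (<-≤-trans 2Xᵇ<4ᵐ 4ᵐ≤2L)

8[h+1]²<4^h : ∀ {h} → 4 ≤ h → 8 * (suc h * suc h) < 4 ^ h
8[h+1]²<4^h {suc (suc (suc (suc t)))} (s≤s (s≤s (s≤s (s≤s z≤n)))) = go t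
  where
  go : ∀ t → 8 * ((5 + t) * (5 + t)) < 4 ^ (4 + t)
  go zero    = m≤m+n 201 55
  go (suc t) = begin-strict
    8 * ((6 + t) * (6 + t))                  ≤⟨ *-monoʳ-≤ 8 (*-mono-≤ 6+t≤2[5+t] 6+t≤2[5+t]) ⟩
    8 * ((2 * (5 + t)) * (2 * (5 + t)))      ≡⟨ regroup (5 + t) ⟩
    4 * (8 * ((5 + t) * (5 + t)))            <⟨ *-monoʳ-< 4 (go t) ⟩
    4 * 4 ^ (4 + t)                          ∎
    where
    open ≤-Reasoning
    double-expand : ∀ t → 2 * (5 + t) ≡ 6 + t + (4 + t)
    double-expand = solve-∀
    6+t≤2[5+t] : 6 + t ≤ 2 * (5 + t)
    6+t≤2[5+t] = subst (6 + t ≤_) (sym (double-expand t)) (m≤m+n (6 + t) (4 + t))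
    regroup : ∀ x → 8 * ((2 * x) * (2 * x)) ≡ 4 * (8 * (x * x))
    regroup = solve-∀

halve : ∀ n → ∃ λ h → h + h ≤ n × n ≤ suc (h + h)
halve zero          = 0 , z≤n , z≤n
halve (suc zero)    = 0 , z≤n , s≤s z≤n
halve (suc (suc n)) with halve n
... | h , 2h≤n , n≤2h+1 = suc h , s≤s (subst (_≤ suc n) (sym (+-suc h h)) (s≤s 2h≤n))
                        , s≤s (s≤s (subst (n ≤_) (sym (+-suc h h)) n≤2h+1))

∃prime-between : ∀ {b} → 3 ≤ b → ∃ λ r → Prime r × b < r × r < b * b
∃prime-between {suc n} 3≤b with halve n
... | h , 2h≤n , n≤2h+1 with 4 ≤? h
...   | yes 4≤h = ∃prime-between-square {h = h} (s≤s 2h≤n) (begin-strict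
  2 * (suc n * suc n)                       ≤⟨ *-monoʳ-≤ 2 (*-mono-≤ b≤2h+2 b≤2h+2) ⟩
  2 * (suc (suc (h + h)) * suc (suc (h + h))) ≡⟨ regroup h ⟩
  8 * (suc h * suc h)                       <⟨ 8[h+1]²<4^h 4≤h ⟩
  4 ^ h                                     ∎)
  where
  open ≤-Reasoning
  b≤2h+2 : suc n ≤ suc (suc (h + h))
  b≤2h+2 = s≤s n≤2h+1
  regroup : ∀ h → 2 * (suc (suc (h + h)) * suc (suc (h + h))) ≡ 8 * (suc h * suc h)
  regroup = solve-∀
...   | no 4≰h with suc n ≤? 4
...     | yes b≤4 = 5 , from-yes (prime? 5) , s≤s b≤4 , ≤-trans (m≤m+n 6 3) (*-mono-≤ 3≤b 3≤b)
...     | no b≰4 =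
  11 , from-yes (prime? 11) , s≤s (≤-trans b≤8 (m≤m+n 8 2)) , ≤-trans (m≤m+n 12 13) (*-mono-≤ 5≤b 5≤b)
  where
  5≤b : 5 ≤ suc n
  5≤b = ≰⇒> b≰4
  b≤8 : suc n ≤ 8
  b≤8 = s≤s (≤-trans n≤2h+1 (s≤s (+-mono-≤ h≤3 h≤3)))
    where
    h≤3 : h ≤ 3
    h≤3 = s≤s⁻¹ (≰⇒> 4≰h)

circProd≢nothing⇔allCoeff : ∀ ws k → circProd ws k ≢ nothing ⇔ T (allCoeff ws k)
circProd≢nothing⇔allCoeff ws k with allCoeff ws k
... | true  = mk⇔ (λ _ → tt) (λ _ ())
... | false = mk⇔ (λ ≢nothing → ≢nothing refl) (λ ())

allCoeff-coNumbers⇔All∤ : ∀ {A : Set} (f : A → ℕ) xs q →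
  T (allCoeff (map (λ x → coNumber (f x)) xs) (ℤ.+ q)) ⇔ All (λ x → ¬ f x ∣ q) xs
allCoeff-coNumbers⇔All∤ f []       q = mk⇔ (λ _ → []) (λ _ → tt)
allCoeff-coNumbers⇔All∤ f (x ∷ xs) q with f x ∣? q
... | yes fx∣q = mk⇔ (λ ()) (λ { (fx∤q ∷ _) → fx∤q fx∣q })
... | no  fx∤q = mk⇔ (λ all → fx∤q ∷ Equivalence.to (allCoeff-coNumbers⇔All∤ f xs q) all)
                     (λ { (_ ∷ all) → Equivalence.from (allCoeff-coNumbers⇔All∤ f xs q) all })

U≢nothing⇔sieved : ∀ p N q → U p N (ℤ.+ q) ≢ nothing ⇔ (∀ {i} → i < N → ¬ p (suc i) ∣ q)
U≢nothing⇔sieved p N q = mk⇔ sieved-if-nonzero nonzero-if-sieved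
  where
  open Equivalence
  nonzero = circProd≢nothing⇔allCoeff (map (λ i → coNumber (p (suc i))) (upTo N)) (ℤ.+ q)
  coNumbers = allCoeff-coNumbers⇔All∤ (λ i → p (suc i)) (upTo N) q
  sieved-if-nonzero : U p N (ℤ.+ q) ≢ nothing → ∀ {i} → i < N → ¬ p (suc i) ∣ q
  sieved-if-nonzero U≢nothing = applyUpTo⁻ id N (to coNumbers (to nonzero U≢nothing))
  nonzero-if-sieved : (∀ {i} → i < N → ¬ p (suc i) ∣ q) → U p N (ℤ.+ q) ≢ nothing
  nonzero-if-sieved sieved = from nonzero (from coNumbers (applyUpTo⁺₁ id N sieved))

n^2≡n*n : ∀ n → n ^ 2 ≡ n * n
n^2≡n*n n = cong (n *_) (*-identityʳ n)

module PrimeEnumeration {p : ℕ → ℕ} (enum : IsPrimeEnumeration p) where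

  p-prime : ∀ i → Prime (p (suc i))
  p-prime = proj₁ enum

  p-strictMono : ∀ i j → i < j → p (suc i) < p (suc j)
  p-strictMono = proj₁ (proj₂ enum)

  p-onto : ∀ q → Prime q → ∃ λ i → p (suc i) ≡ q
  p-onto = proj₂ (proj₂ enum)

  p-mono-≤ : ∀ {i j} → i ≤ j → p (suc i) ≤ p (suc j)
  p-mono-≤ {i} {j} i≤j with m≤n⇒m<n∨m≡n i≤j
  ... | inj₁ i<j  = <⇒≤ (p-strictMono i j i<j)
  ... | inj₂ refl = ≤-refl

  p-cancel-< : ∀ {i j} → p (suc i) < p (suc j) → i < j
  p-cancel-< pᵢ<pⱼ = ≰⇒> (λ j≤i → <⇒≱ pᵢ<pⱼ (p-mono-≤ j≤i))

  p[N+2]-least : ∀ N {r} → Prime r → p (suc N) < r → p (suc (suc N)) ≤ r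
  p[N+2]-least N {r} r-prime p[N+1]<r with p-onto r r-prime
  ... | i , refl = p-mono-≤ (p-cancel-< p[N+1]<r)

  sieved⇒rough : ∀ N {q} → (∀ {i} → i < N → ¬ p (suc i) ∣ q) → p (suc N) Rough q
  sieved⇒rough N sieved (hasNonTrivialDivisor {d} d<p[N+1] d∣q)
    with ∃prime∣ (nonTrivial⇒n>1 d)
  ... | r , r-prime , r∣d with p-onto r r-prime
  ...   | i , refl =
    sieved (p-cancel-< (≤-<-trans (∣⇒≤ {{nonTrivial⇒nonZero d}} r∣d) d<p[N+1])) (∣-trans r∣d d∣q)

  prime≥p[N+1]⇒sieved : ∀ N {q} → Prime q → p (suc N) ≤ q → ∀ {i} → i < N → ¬ p (suc i) ∣ q
  prime≥p[N+1]⇒sieved N {q} q-prime p[N+1]≤q {i} i<N pᵢ∣q with prime⇒irreducible q-prime pᵢ∣q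
  ... | inj₁ pᵢ≡1 = contradiction pᵢ≡1 (>⇒≢ (prime⇒2≤ (p-prime i)))
  ... | inj₂ pᵢ≡q = <⇒≱ (p-strictMono i N i<N) (subst (p (suc N) ≤_) (sym pᵢ≡q) p[N+1]≤q)

  identified⇔prime<square : ∀ N q → Identified p N q ⇔ (Prime q × q < p (suc N) ^ 2)
  identified⇔prime<square N q = mk⇔ identified⇒prime identified-if-prime
    where
    open Equivalence
    b = p (suc N)
    b<b² : b < b ^ 2
    b<b² = subst (b <_) (sym (n^2≡n*n b))
      (m<m*n b b {{prime⇒nonZero (p-prime N)}} (prime⇒2≤ (p-prime N)))
    identified⇒prime : Identified p N q → Prime q × q < b ^ 2
    identified⇒prime (inj₁ (suc j , (_ , j<N+1) , refl)) =
      p-prime j , ≤-<-trans (p-mono-≤ (s≤s⁻¹ (m≤n⇒m≤1+n j<N+1))) b<b²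
    identified⇒prime (inj₂ ((b≤q , q<b²) , U≢nothing)) =
      rough∧square>⇒prime {{n>1⇒nonTrivial (≤-trans (prime⇒2≤ (p-prime N)) b≤q)}}
        (sieved⇒rough N (to (U≢nothing⇔sieved p N q) U≢nothing))
        (subst (q <_) (n^2≡n*n b) q<b²)
      , q<b²
    identified-if-prime : Prime q × q < b ^ 2 → Identified p N q
    identified-if-prime (q-prime , q<b²) with p-onto q q-prime
    ... | i , pᵢ≡q with suc i ≤? N
    ...   | yes i<N = inj₁ (suc i , (s≤s z≤n , i<N) , sym pᵢ≡q)
    ...   | no  i≮N =
      inj₂ ((b≤q , q<b²) , from (U≢nothing⇔sieved p N q) (prime≥p[N+1]⇒sieved N q-prime b≤q))
      where
      b≤q : b ≤ q
      b≤q = subst (b ≤_) pᵢ≡q (p-mono-≤ (s≤s⁻¹ (≰⇒> i≮N)))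

  p[N+2]<p[N+1]² : ∀ {N} → 1 ≤ N → p (suc (suc N)) < p (suc N) ^ 2
  p[N+2]<p[N+1]² {N} 1≤N
    with ∃prime-between (<-≤-trans (s≤s (prime⇒2≤ (p-prime 0))) (p-strictMono 0 N 1≤N))
  ... | r , r-prime , b<r , r<b² = subst (p (suc (suc N)) <_) (sym (n^2≡n*n (p (suc N))))
                                     (≤-<-trans (p[N+2]-least N r-prime b<r) r<b²)

mainTheorem6 : (p : ℕ → ℕ) → IsPrimeEnumeration p →
    (N : ℕ) → 1 ≤ N →
    ((q : ℕ) → Identified p N q ⇔ (Prime q × q < p (suc N) ^ 2)) ×
    (Identified p N (p (suc (suc N))) ×
    ((q : ℕ) → Identified p N q → p (suc N) < q → p (suc (suc N)) ≤ q))
mainTheorem6 p enum N 1≤N =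
    identified⇔prime<square N
  , from (identified⇔prime<square N (p (suc (suc N)))) (p-prime (suc N) , p[N+2]<p[N+1]² 1≤N)
  , λ q q-identified p[N+1]<q →
      p[N+2]-least N (proj₁ (to (identified⇔prime<square N q) q-identified)) p[N+1]<q
  where
  open PrimeEnumeration {p} enum
  open Equivalence
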